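{- Let $\mathcal{V}$ be a variety consisting of right-residuated l-groupoids satisfying the double negation law and divisibility. Then $\mathcal{V}$ is arithmetical and congruence regular.
   Context: A right-residuated l-groupoid is an algebra $(L,\vee,\wedge,\odot,\rightarrow,0,1)$ of type $(2,2,2,2,0,0)$ such that $(L,\vee,\wedge)$ is a lattice with least element $0$ and greatest element $1$, $1\odot x=x$ for all $x$, and $x\odot y\le z$ iff $x\le y\rightarrow z$ for all $x,y,z$. Put $\rceil x:=x\rightarrow 0$; the double negation law is $\rceil\rceil x=x$; divisibility is $(x\rightarrow y)\odot x=x\wedge y$ for all $x,y$. A variety is arithmetical if each of its algebras is congruence distributive and congruence permutable; it is congruence regular if in each of its algebras every congruence $\theta$ is determined by any one of its classes, i.e. $\theta[a]=\varphi[a]$ for some element $a$ implies $\theta=\varphi$. -}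

module Defs where

open import Level using (Level; _⊔_; suc)
open import Data.Product using (Σ; _×_; _,_)
open import Data.Sum using (_⊎_)
open import Relation.Binary.PropositionalEquality using (_≡_)
open import Relation.Binary.Core using (Rel)
open import Relation.Binary.Structures using (IsEquivalence)
open import Algebra.Lattice.Structures using (IsLattice)

record RRLGroupoid (a : Level) : Set (suc a) where
  infixr 6 _∨_
  infixr 7 _∧_
  infixl 8 _⊙_
  infixr 5 _⇒_
  infix 4 _≤_
  field
    Carrier : Set a
    _∨_ _∧_ _⊙_ _⇒_ : Carrier → Carrier → Carrier
    𝟘 𝟙 : Carrier
    isLattice : IsLattice _≡_ _∨_ _∧_

  _≤_ : Carrier → Carrier → Set a
  x ≤ y = x ∧ y ≡ x

  field
    𝟘-least    : ∀ x → 𝟘 ≤ x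
    𝟙-greatest : ∀ x → x ≤ 𝟙
    𝟙-identity : ∀ x → 𝟙 ⊙ x ≡ x
    residuation-to   : ∀ x y z → x ⊙ y ≤ z → x ≤ y ⇒ z
    residuation-from : ∀ x y z → x ≤ y ⇒ z → x ⊙ y ≤ z

  ⌉_ : Carrier → Carrier
  ⌉ x = x ⇒ 𝟘

module _ {a : Level} (L : RRLGroupoid a) where
  open RRLGroupoid L

  DoubleNegation : Set a
  DoubleNegation = ∀ x → ⌉ (⌉ x) ≡ x

  Divisibility : Set a
  Divisibility = ∀ x y → (x ⇒ y) ⊙ x ≡ x ∧ y

  record IsCongruence {ℓ : Level} (θ : Rel Carrier ℓ) : Set (a ⊔ ℓ) where
    field
      isEquivalence : IsEquivalence θ
      ∨-cong : ∀ {x x′ y y′} → θ x x′ → θ y y′ → θ (x ∨ y) (x′ ∨ y′)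
      ∧-cong : ∀ {x x′ y y′} → θ x x′ → θ y y′ → θ (x ∧ y) (x′ ∧ y′)
      ⊙-cong : ∀ {x x′ y y′} → θ x x′ → θ y y′ → θ (x ⊙ y) (x′ ⊙ y′)
      ⇒-cong : ∀ {x x′ y y′} → θ x x′ → θ y y′ → θ (x ⇒ y) (x′ ⇒ y′)

  record Congruence (ℓ : Level) : Set (a ⊔ suc ℓ) where
    field
      rel : Rel Carrier ℓ
      isCongruence : IsCongruence rel

module _ {a : Level} {A : Set a} where

  _⊆ᵣ_ : ∀ {ℓ₁ ℓ₂} → Rel A ℓ₁ → Rel A ℓ₂ → Set (a ⊔ ℓ₁ ⊔ ℓ₂)
  R ⊆ᵣ S = ∀ {x y} → R x y → S x y

  _≐_ : ∀ {ℓ₁ ℓ₂} → Rel A ℓ₁ → Rel A ℓ₂ → Set (a ⊔ ℓ₁ ⊔ ℓ₂)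
  R ≐ S = (R ⊆ᵣ S) × (S ⊆ᵣ R)

  _∩ᵣ_ : ∀ {ℓ₁ ℓ₂} → Rel A ℓ₁ → Rel A ℓ₂ → Rel A (ℓ₁ ⊔ ℓ₂)
  (R ∩ᵣ S) x y = R x y × S x y

  _∘ᵣ_ : ∀ {ℓ₁ ℓ₂} → Rel A ℓ₁ → Rel A ℓ₂ → Rel A (a ⊔ ℓ₁ ⊔ ℓ₂)
  (R ∘ᵣ S) x z = Σ A λ y → R x y × S y z

  data TC {ℓ : Level} (R : Rel A ℓ) : Rel A (a ⊔ ℓ) where
    [_] : ∀ {x y} → R x y → TC R x y
    _∷_ : ∀ {x y z} → R x y → TC R y z → TC R x z

  _∨ᵣ_ : ∀ {ℓ₁ ℓ₂} → Rel A ℓ₁ → Rel A ℓ₂ → Rel A (a ⊔ ℓ₁ ⊔ ℓ₂)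
  R ∨ᵣ S = TC (λ x y → R x y ⊎ S x y)

module _ {a : Level} (L : RRLGroupoid a) where
  open RRLGroupoid L
  open Congruence

  CongruenceDistributive : (ℓ : Level) → Set (a ⊔ suc ℓ)
  CongruenceDistributive ℓ = (θ φ ψ : Congruence L ℓ) →
    (rel θ ∩ᵣ (rel φ ∨ᵣ rel ψ)) ≐ ((rel θ ∩ᵣ rel φ) ∨ᵣ (rel θ ∩ᵣ rel ψ))

  CongruencePermutable : (ℓ : Level) → Set (a ⊔ suc ℓ)
  CongruencePermutable ℓ = (θ φ : Congruence L ℓ) →
    (rel θ ∘ᵣ rel φ) ≐ (rel φ ∘ᵣ rel θ)

  CongruenceRegular : (ℓ : Level) → Set (a ⊔ suc ℓ)
  CongruenceRegular ℓ = (θ φ : Congruence L ℓ) (c : Carrier) →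
    (∀ x → (rel θ c x → rel φ c x) × (rel φ c x → rel θ c x)) →
    rel θ ≐ rel φ

-- Meet and join give the majority term m(x,y,z) = (x ∧ y) ∨ (y ∧ z) ∨ (z ∧ x), so every
-- congruence lattice is distributive (Jónsson).  Divisibility turns
-- p(x,y,z) = ((y → x) ⊙ z) ∨ ((y → z) ⊙ x) into a Maltsev term, since
-- (x → x) ⊙ z = z and (z → x) ⊙ z = z ∧ x; hence congruences permute.  For regularity,
-- divisibility together with double negation shows that θ is determined by its 0-class
-- (x θ y iff ⌉(x → y) θ 0 and ⌉(y → x) θ 0), and any class θ[c] determines the 0-class:
-- if x θ 0 then c ∨ x and ⌉(c → x) lie in θ[c]; so if θ[c] ⊆ φ[c], they lie in φ[c] too,
-- whence x φ c ∧ x = (c → x) ⊙ c φ ⌉c ⊙ c = 0.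
module Submission where

open import Defs
open import Level using (Level; _⊔_)
open import Data.Product using (_×_; _,_; proj₁; proj₂)
open import Data.Sum using (_⊎_; inj₁; inj₂) renaming ([_,_] to either; map to ⊎-map)
open import Function using (id)
open import Relation.Binary.Core using (Rel)
open import Relation.Binary.Bundles using (Setoid)
open import Relation.Binary.Definitions using (Reflexive; Symmetric; Transitive)
open import Relation.Binary.Structures using (IsEquivalence)
open import Relation.Binary.PropositionalEquality
  using (_≡_; cong; cong₂; subst; subst₂; module ≡-Reasoning)
import Relation.Binary.PropositionalEquality as ≡
open import Algebra.Lattice.Bundles using (Lattice)
import Algebra.Lattice.Properties.Lattice as LatticeProperties
import Relation.Binary.Reasoning.Setoid as SetoidReasoning

module _ {a : Level} {A : Set a} where

  Compatible₃ : ∀ {ℓ} → (A → A → A → A) → Rel A ℓ → Set (a ⊔ ℓ)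
  Compatible₃ f R = ∀ {x x′ y y′ z z′} → R x x′ → R y y′ → R z z′ → R (f x y z) (f x′ y′ z′)

  record IsMajority (m : A → A → A → A) : Set a where
    field
      m-xxy : ∀ x y → m x x y ≡ x
      m-xyx : ∀ x y → m x y x ≡ x
      m-yxx : ∀ x y → m y x x ≡ x

  record IsMaltsev (p : A → A → A → A) : Set a where
    field
      p-xyy : ∀ x y → p x y y ≡ x
      p-xxy : ∀ x y → p x x y ≡ y

  TC-image : ∀ {ℓ₁ ℓ₂} {R : Rel A ℓ₁} {S : Rel A ℓ₂} (f : A → A) →
             (∀ {x y} → R x y → S (f x) (f y)) →
             ∀ {x y} → TC R x y → TC S (f x) (f y)
  TC-image f R⇒S [ r ]      = [ R⇒S r ]
  TC-image f R⇒S (r ∷ rs) = R⇒S r ∷ TC-image f R⇒S rs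

  TC-least : ∀ {ℓ₁ ℓ₂} {R : Rel A ℓ₁} {S : Rel A ℓ₂} →
             Transitive S → R ⊆ᵣ S → TC R ⊆ᵣ S
  TC-least trans-S R⊆S [ r ]      = R⊆S r
  TC-least trans-S R⊆S (r ∷ rs) = trans-S (R⊆S r) (TC-least trans-S R⊆S rs)

  ∩-∨-distrib-⊇ : ∀ {ℓ} {θ φ ψ : Rel A ℓ} → Transitive θ →
                  ((θ ∩ᵣ φ) ∨ᵣ (θ ∩ᵣ ψ)) ⊆ᵣ (θ ∩ᵣ (φ ∨ᵣ ψ))
  ∩-∨-distrib-⊇ trans-θ rs =
    TC-least trans-θ (either proj₁ proj₁) rs , TC-image id (⊎-map proj₂ proj₂) rs

  module _ {m : A → A → A → A} (majority : IsMajority m) where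
    open IsMajority majority

    -- c ↦ m x c y maps a (φ ∨ ψ)-chain from x to y onto one from m x x y = x to m x y y = y,
    -- and all its points are θ-related to m x c x = x.
    majority⇒∩-∨-distrib-⊆ : ∀ {ℓ} {θ φ ψ : Rel A ℓ} → IsEquivalence θ →
      Reflexive φ → Reflexive ψ → Compatible₃ m θ → Compatible₃ m φ → Compatible₃ m ψ →
      (θ ∩ᵣ (φ ∨ᵣ ψ)) ⊆ᵣ ((θ ∩ᵣ φ) ∨ᵣ (θ ∩ᵣ ψ))
    majority⇒∩-∨-distrib-⊆ {θ = θ} {φ} {ψ} θ-equiv refl-φ refl-ψ m-θ m-φ m-ψ {x} {y} (xθy , xφψy) =
      subst₂ (TC _) (m-xxy x y) (m-yxx y x) (TC-image (λ c → m x c y) step xφψy)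
      where
      open IsEquivalence θ-equiv renaming (refl to refl-θ; sym to sym-θ; trans to trans-θ)

      m-x-c-y-θ-x : ∀ c → θ (m x c y) x
      m-x-c-y-θ-x c = subst (θ (m x c y)) (m-xyx x c) (m-θ refl-θ refl-θ (sym-θ xθy))

      θ-between : ∀ c d → θ (m x c y) (m x d y)
      θ-between c d = trans-θ (m-x-c-y-θ-x c) (sym-θ (m-x-c-y-θ-x d))

      step : ∀ {c d} → φ c d ⊎ ψ c d →
             (θ ∩ᵣ φ) (m x c y) (m x d y) ⊎ (θ ∩ᵣ ψ) (m x c y) (m x d y)
      step {c} {d} (inj₁ cφd) = inj₁ (θ-between c d , m-φ refl-φ cφd refl-φ)
      step {c} {d} (inj₂ cψd) = inj₂ (θ-between c d , m-ψ refl-ψ cψd refl-ψ)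

    majority⇒∩-∨-distrib : ∀ {ℓ} {θ φ ψ : Rel A ℓ} → IsEquivalence θ →
      Reflexive φ → Reflexive ψ → Compatible₃ m θ → Compatible₃ m φ → Compatible₃ m ψ →
      (θ ∩ᵣ (φ ∨ᵣ ψ)) ≐ ((θ ∩ᵣ φ) ∨ᵣ (θ ∩ᵣ ψ))
    majority⇒∩-∨-distrib θ-equiv refl-φ refl-ψ m-θ m-φ m-ψ =
      majority⇒∩-∨-distrib-⊆ θ-equiv refl-φ refl-ψ m-θ m-φ m-ψ ,
      ∩-∨-distrib-⊇ (IsEquivalence.trans θ-equiv)

  module _ {p : A → A → A → A} (maltsev : IsMaltsev p) where
    open IsMaltsev maltsev

    -- For x θ y φ z the witness is p x y z: x = p x z z φ p x y z θ p x x z = z.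
    maltsev⇒∘-comm-⊆ : ∀ {ℓ} {θ φ : Rel A ℓ} →
      Reflexive θ → Symmetric θ → Reflexive φ → Symmetric φ →
      Compatible₃ p θ → Compatible₃ p φ → (θ ∘ᵣ φ) ⊆ᵣ (φ ∘ᵣ θ)
    maltsev⇒∘-comm-⊆ {θ = θ} {φ} refl-θ sym-θ refl-φ sym-φ p-θ p-φ {x} {z} (y , xθy , yφz) =
      p x y z ,
      subst (λ w → φ w (p x y z)) (p-xyy x z) (p-φ refl-φ (sym-φ yφz) refl-φ) ,
      subst (θ (p x y z)) (p-xxy x z) (p-θ refl-θ (sym-θ xθy) refl-θ)

    maltsev⇒∘-comm : ∀ {ℓ} {θ φ : Rel A ℓ} → IsEquivalence θ → IsEquivalence φ →
      Compatible₃ p θ → Compatible₃ p φ → (θ ∘ᵣ φ) ≐ (φ ∘ᵣ θ)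
    maltsev⇒∘-comm {θ = θ} {φ} θ-equiv φ-equiv p-θ p-φ =
      maltsev⇒∘-comm-⊆ {θ = θ} {φ} θ.refl θ.sym φ.refl φ.sym p-θ p-φ ,
      maltsev⇒∘-comm-⊆ {θ = φ} {θ} φ.refl φ.sym θ.refl θ.sym p-φ p-θ
      where
      module θ = IsEquivalence θ-equiv
      module φ = IsEquivalence φ-equiv

module _ {a : Level} (L : RRLGroupoid a) where
  open RRLGroupoid L
  open Congruence

  private
    lattice : Lattice a a
    lattice = record { isLattice = isLattice }

  open Lattice lattice using (∨-comm; ∨-assoc; ∧-comm; ∨-absorbs-∧; ∧-absorbs-∨)
  open LatticeProperties lattice using (∧-idem; ∨-idem)

  ≤-antisym : ∀ {x y} → x ≤ y → y ≤ x → x ≡ y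
  ≤-antisym {x} {y} x≤y y≤x = ≡.trans (≡.sym x≤y) (≡.trans (∧-comm x y) y≤x)

  ≤⇒⇒≡𝟙 : ∀ {x y} → x ≤ y → x ⇒ y ≡ 𝟙
  ≤⇒⇒≡𝟙 {x} {y} x≤y = ≤-antisym (𝟙-greatest _)
    (residuation-to 𝟙 x y (subst (_≤ y) (≡.sym (𝟙-identity x)) x≤y))

  ⇒-refl : ∀ x → x ⇒ x ≡ 𝟙
  ⇒-refl x = ≤⇒⇒≡𝟙 (∧-idem x)

  ⌉𝟘≡𝟙 : ⌉ 𝟘 ≡ 𝟙
  ⌉𝟘≡𝟙 = ⇒-refl 𝟘

  ∧-zeroʳ : ∀ x → x ∧ 𝟘 ≡ 𝟘
  ∧-zeroʳ x = ≡.trans (∧-comm x 𝟘) (𝟘-least x)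

  ∨-identityʳ : ∀ x → x ∨ 𝟘 ≡ x
  ∨-identityʳ x = ≡.trans (cong (x ∨_) (≡.sym (∧-zeroʳ x))) (∨-absorbs-∧ x 𝟘)

  module CongruenceReasoning {ℓ : Level} (θ : Congruence L ℓ) where
    open IsCongruence (isCongruence θ) public
    open IsEquivalence isEquivalence public

    setoid : Setoid a ℓ
    setoid = record { isEquivalence = isEquivalence }

    open SetoidReasoning setoid public

    infix 4 _≈_
    _≈_ : Rel Carrier ℓ
    _≈_ = rel θ

    ⌉-cong : ∀ {x y} → x ≈ y → ⌉ x ≈ ⌉ y
    ⌉-cong x~y = ⇒-cong x~y refl

  majority : Carrier → Carrier → Carrier → Carrier
  majority x y z = (x ∧ y) ∨ ((y ∧ z) ∨ (z ∧ x))

  majority-isMajority : IsMajority majority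
  majority-isMajority = record { m-xxy = m-xxy ; m-xyx = m-xyx ; m-yxx = m-yxx }
    where
    open ≡-Reasoning

    m-xxy : ∀ x y → majority x x y ≡ x
    m-xxy x y = begin
      (x ∧ x) ∨ ((x ∧ y) ∨ (y ∧ x))  ≡⟨ cong₂ _∨_ (∧-idem x) (cong ((x ∧ y) ∨_) (∧-comm y x)) ⟩
      x ∨ ((x ∧ y) ∨ (x ∧ y))        ≡⟨ cong (x ∨_) (∨-idem (x ∧ y)) ⟩
      x ∨ (x ∧ y)                    ≡⟨ ∨-absorbs-∧ x y ⟩
      x                              ∎

    m-xyx : ∀ x y → majority x y x ≡ x
    m-xyx x y = begin
      (x ∧ y) ∨ ((y ∧ x) ∨ (x ∧ x))  ≡⟨ cong ((x ∧ y) ∨_) (cong₂ _∨_ (∧-comm y x) (∧-idem x)) ⟩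
      (x ∧ y) ∨ ((x ∧ y) ∨ x)        ≡⟨ ∨-assoc (x ∧ y) (x ∧ y) x ⟨
      ((x ∧ y) ∨ (x ∧ y)) ∨ x        ≡⟨ cong (_∨ x) (∨-idem (x ∧ y)) ⟩
      (x ∧ y) ∨ x                    ≡⟨ ∨-comm (x ∧ y) x ⟩
      x ∨ (x ∧ y)                    ≡⟨ ∨-absorbs-∧ x y ⟩
      x                              ∎

    m-yxx : ∀ x y → majority y x x ≡ x
    m-yxx x y = begin
      (y ∧ x) ∨ ((x ∧ x) ∨ (x ∧ y))  ≡⟨ cong ((y ∧ x) ∨_) (cong (_∨ (x ∧ y)) (∧-idem x)) ⟩
      (y ∧ x) ∨ (x ∨ (x ∧ y))        ≡⟨ cong ((y ∧ x) ∨_) (∨-absorbs-∧ x y) ⟩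
      (y ∧ x) ∨ x                    ≡⟨ ∨-comm (y ∧ x) x ⟩
      x ∨ (y ∧ x)                    ≡⟨ cong (x ∨_) (∧-comm y x) ⟩
      x ∨ (x ∧ y)                    ≡⟨ ∨-absorbs-∧ x y ⟩
      x                              ∎

  majority-compatible : ∀ {ℓ} (θ : Congruence L ℓ) → Compatible₃ majority (rel θ)
  majority-compatible θ x~x′ y~y′ z~z′ =
    ∨-cong (∧-cong x~x′ y~y′) (∨-cong (∧-cong y~y′ z~z′) (∧-cong z~z′ x~x′))
    where open CongruenceReasoning θ

  congruenceDistributive : ∀ ℓ → CongruenceDistributive L ℓ
  congruenceDistributive ℓ θ φ ψ =
    majority⇒∩-∨-distrib majority-isMajority
      (isEquivalence θ) (refl φ) (refl ψ)
      (majority-compatible θ) (majority-compatible φ) (majority-compatible ψ)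
    where open CongruenceReasoning using (isEquivalence; refl)

  maltsev : Carrier → Carrier → Carrier → Carrier
  maltsev x y z = ((y ⇒ x) ⊙ z) ∨ ((y ⇒ z) ⊙ x)

  maltsev-compatible : ∀ {ℓ} (θ : Congruence L ℓ) → Compatible₃ maltsev (rel θ)
  maltsev-compatible θ x~x′ y~y′ z~z′ =
    ∨-cong (⊙-cong (⇒-cong y~y′ x~x′) z~z′) (⊙-cong (⇒-cong y~y′ z~z′) x~x′)
    where open CongruenceReasoning θ

  module _ (divisible : Divisibility L) where

    maltsev-isMaltsev : IsMaltsev maltsev
    maltsev-isMaltsev = record { p-xyy = p-xyy ; p-xxy = p-xxy }
      where
      open ≡-Reasoning

      p-xyy : ∀ x y → maltsev x y y ≡ x
      p-xyy x y = begin
        ((y ⇒ x) ⊙ y) ∨ ((y ⇒ y) ⊙ x)  ≡⟨ cong₂ _∨_ (divisible y x) (cong (_⊙ x) (⇒-refl y)) ⟩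
        (y ∧ x) ∨ (𝟙 ⊙ x)              ≡⟨ cong₂ _∨_ (∧-comm y x) (𝟙-identity x) ⟩
        (x ∧ y) ∨ x                    ≡⟨ ∨-comm (x ∧ y) x ⟩
        x ∨ (x ∧ y)                    ≡⟨ ∨-absorbs-∧ x y ⟩
        x                              ∎

      p-xxy : ∀ x y → maltsev x x y ≡ y
      p-xxy x y = begin
        ((x ⇒ x) ⊙ y) ∨ ((x ⇒ y) ⊙ x)  ≡⟨ cong₂ _∨_ (cong (_⊙ y) (⇒-refl x)) (divisible x y) ⟩
        (𝟙 ⊙ y) ∨ (x ∧ y)              ≡⟨ cong₂ _∨_ (𝟙-identity y) (∧-comm x y) ⟩
        y ∨ (y ∧ x)                    ≡⟨ ∨-absorbs-∧ y x ⟩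
        y                              ∎

    congruencePermutable : ∀ ℓ → CongruencePermutable L ℓ
    congruencePermutable ℓ θ φ =
      maltsev⇒∘-comm maltsev-isMaltsev (isEquivalence θ) (isEquivalence φ)
        (maltsev-compatible θ) (maltsev-compatible φ)
      where open CongruenceReasoning using (isEquivalence)

    ⌉x⊙x≡𝟘 : ∀ x → ⌉ x ⊙ x ≡ 𝟘
    ⌉x⊙x≡𝟘 x = ≡.trans (divisible x 𝟘) (∧-zeroʳ x)

    module _ {ℓ : Level} (θ : Congruence L ℓ) where
      open CongruenceReasoning θ

      ⇒≈𝟙⇒≈ : ∀ {x y} → x ⇒ y ≈ 𝟙 → y ⇒ x ≈ 𝟙 → x ≈ y
      ⇒≈𝟙⇒≈ {x} {y} x⇒y~𝟙 y⇒x~𝟙 = begin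
        x              ≡⟨ 𝟙-identity x ⟨
        𝟙 ⊙ x          ≈⟨ ⊙-cong x⇒y~𝟙 refl ⟨
        (x ⇒ y) ⊙ x    ≡⟨ divisible x y ⟩
        x ∧ y          ≡⟨ ∧-comm x y ⟩
        y ∧ x          ≡⟨ divisible y x ⟨
        (y ⇒ x) ⊙ y    ≈⟨ ⊙-cong y⇒x~𝟙 refl ⟩
        𝟙 ⊙ y          ≡⟨ 𝟙-identity y ⟩
        y              ∎

  module _ (doubleNegation : DoubleNegation L) where

    ⌉𝟙≡𝟘 : ⌉ 𝟙 ≡ 𝟘
    ⌉𝟙≡𝟘 = ≡.trans (cong ⌉_ (≡.sym ⌉𝟘≡𝟙)) (doubleNegation 𝟘)

    module _ {ℓ : Level} (θ : Congruence L ℓ) where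
      open CongruenceReasoning θ

      ≈⇒⌉⇒≈𝟘 : ∀ {x y} → x ≈ y → ⌉ (x ⇒ y) ≈ 𝟘
      ≈⇒⌉⇒≈𝟘 {x} {y} x~y = begin
        ⌉ (x ⇒ y)  ≈⟨ ⌉-cong (⇒-cong refl x~y) ⟨
        ⌉ (x ⇒ x)  ≡⟨ cong ⌉_ (⇒-refl x) ⟩
        ⌉ 𝟙        ≡⟨ ⌉𝟙≡𝟘 ⟩
        𝟘          ∎

      ⌉≈𝟘⇒≈𝟙 : ∀ {x} → ⌉ x ≈ 𝟘 → x ≈ 𝟙
      ⌉≈𝟘⇒≈𝟙 {x} ⌉x~𝟘 = begin
        x          ≡⟨ doubleNegation x ⟨
        ⌉ (⌉ x)    ≈⟨ ⌉-cong ⌉x~𝟘 ⟩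
        ⌉ 𝟘        ≡⟨ ⌉𝟘≡𝟙 ⟩
        𝟙          ∎

    module _ (divisible : Divisibility L) {ℓ : Level} (θ φ : Congruence L ℓ) where

      𝟘-class⊆⇒⊆ : (∀ {x} → rel θ x 𝟘 → rel φ x 𝟘) → rel θ ⊆ᵣ rel φ
      𝟘-class⊆⇒⊆ 𝟘θ⊆𝟘φ x~y =
        ⇒≈𝟙⇒≈ divisible φ (⇒≈𝟙 x~y) (⇒≈𝟙 (θ.sym x~y))
        where
        module θ = CongruenceReasoning θ

        ⇒≈𝟙 : ∀ {x y} → rel θ x y → rel φ (x ⇒ y) 𝟙
        ⇒≈𝟙 x~y = ⌉≈𝟘⇒≈𝟙 φ (𝟘θ⊆𝟘φ (≈⇒⌉⇒≈𝟘 θ x~y))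

      class⊆⇒𝟘-class⊆ : ∀ c → (∀ {x} → rel θ c x → rel φ c x) → ∀ {x} → rel θ x 𝟘 → rel φ x 𝟘
      class⊆⇒𝟘-class⊆ c cθ⊆cφ {x} x~𝟘 = begin
        x                ≡⟨ ∧-absorbs-∨ x c ⟨
        x ∧ (x ∨ c)      ≡⟨ cong (x ∧_) (∨-comm x c) ⟩
        x ∧ (c ∨ x)      ≈⟨ ∧-cong refl c∨x~c ⟩
        x ∧ c            ≡⟨ ∧-comm x c ⟩
        c ∧ x            ≡⟨ divisible c x ⟨
        (c ⇒ x) ⊙ c      ≈⟨ ⊙-cong c⇒x~⌉c refl ⟩
        ⌉ c ⊙ c          ≡⟨ ⌉x⊙x≡𝟘 divisible c ⟩
        𝟘                ∎
        where
        open CongruenceReasoning φ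
        module θ = CongruenceReasoning θ

        c~c∨x : rel θ c (c ∨ x)
        c~c∨x = θ.begin
          c        θ.≡⟨ ∨-identityʳ c ⟨
          c ∨ 𝟘    θ.≈⟨ θ.∨-cong θ.refl x~𝟘 ⟨
          c ∨ x    θ.∎

        c~⌉[c⇒x] : rel θ c (⌉ (c ⇒ x))
        c~⌉[c⇒x] = θ.begin
          c          θ.≡⟨ doubleNegation c ⟨
          ⌉ (⌉ c)    θ.≈⟨ θ.⌉-cong (θ.⇒-cong θ.refl x~𝟘) ⟨
          ⌉ (c ⇒ x)  θ.∎

        c∨x~c : c ∨ x ≈ c
        c∨x~c = sym (cθ⊆cφ c~c∨x)

        c⇒x~⌉c : c ⇒ x ≈ ⌉ c
        c⇒x~⌉c = begin
          c ⇒ x          ≡⟨ doubleNegation (c ⇒ x) ⟨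
          ⌉ (⌉ (c ⇒ x))  ≈⟨ ⌉-cong (cθ⊆cφ c~⌉[c⇒x]) ⟨
          ⌉ c            ∎

    congruenceRegular : Divisibility L → ∀ ℓ → CongruenceRegular L ℓ
    congruenceRegular divisible ℓ θ φ c cθ⇔cφ =
      𝟘-class⊆⇒⊆ divisible θ φ (class⊆⇒𝟘-class⊆ divisible θ φ c (proj₁ (cθ⇔cφ _))) ,
      𝟘-class⊆⇒⊆ divisible φ θ (class⊆⇒𝟘-class⊆ divisible φ θ c (proj₂ (cθ⇔cφ _)))

corollary6 : {a ℓ : Level} (L : RRLGroupoid a) →
    DoubleNegation L → Divisibility L →
    (CongruenceDistributive L ℓ × CongruencePermutable L ℓ) × CongruenceRegular L ℓ
corollary6 {ℓ = ℓ} L doubleNegation divisible =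
  (congruenceDistributive L ℓ , congruencePermutable L divisible ℓ) ,
  congruenceRegular L doubleNegation divisible ℓ
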